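{- Let $d\ge2$, $\sigma\in S_d$ and $u\in\mathbb{Z}^d$ with $u_1+\cdots+u_d=0$. Let $h_\sigma\in K^{d\times d}$ be the permutation matrix with $(i,j)$ entry $1$ if $i=\sigma(j)$ and $0$ otherwise, $g_u=\mathrm{diag}(p^{u_1},\dots,p^{u_d})$, and $w=h_\sigma g_u$. Let $C_0=\{[L_1],\dots,[L_d]\}$ with $L_i=\mathrm{diag}(p^{v^{(i)}_1},\dots,p^{v^{(i)}_d})\mathcal{O}_K^d$, $v^{(i)}=(1,\dots,1,0,\dots,0)$ having $i-1$ ones, and $wC_0=\{[wL_1],\dots,[wL_d]\}$. Then $$\mathrm{PZ}(C_0\cup wC_0)=\bigcap_{i=1}^d\mathrm{End}_{\mathcal{O}_K}(L_i)\ \cap\ \bigcap_{i=1}^d\mathrm{End}_{\mathcal{O}_K}(wL_i)$$ equals $\Lambda_{M^{\sigma,u}}=\{X\in K^{d\times d}:\mathrm{val}(x_{ij})\ge M^{\sigma,u}_{ij}\ \forall i,j\}$, where $$M^{\sigma,u}=M_0\ \overline{\oplus}\ \big(P_\sigma\,\underline{\odot}\,D_u\,\underline{\odot}\,M_0\,\underline{\odot}\,D_{ -u}\,\underline{\odot}\,P_{\sigma^{ -1}}\big).$$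
   Context: $K$ is a field with a surjective discrete valuation $\mathrm{val}:K\to\mathbb{Z}\cup\{\infty\}$ (with $\mathrm{val}(0)=+\infty$), $p\in K$ with $\mathrm{val}(p)=1$, $\mathcal{O}_K$ its valuation ring. $[L]$ denotes the class $\{p^nL:n\in\mathbb{Z}\}$ of a lattice $L\subset K^d$; $\mathrm{End}_{\mathcal{O}_K}(L)=\{X:XL\subseteq L\}$ depends only on $[L]$. $M_0=\sum_{1\le i<j\le d}E_{ij}$ (entry $1$ above the diagonal, $0$ elsewhere). $D_u$ is the tropical diagonal matrix with diagonal entries $u_1,\dots,u_d$ and $+\infty$ elsewhere; $P_\sigma=\mathrm{val}(h_\sigma)$ entrywise (entry $0$ at $(\sigma(j),j)$, $+\infty$ elsewhere). $\underline{\odot}$ is the min-plus matrix product $(A\,\underline{\odot}\,B)_{ik}=\min_j(a_{ij}+b_{jk})$ and $\overline{\oplus}$ is entrywise maximum. -}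

module Defs where

open import Level using (Level; _⊔_) renaming (suc to lsuc)
open import Algebra.Bundles using (CommutativeRing)
open import Data.Nat as ℕ using (ℕ)
open import Data.Integer as ℤ using (ℤ; +_; -[1+_]; 0ℤ; 1ℤ)
open import Data.Fin as Fin using (Fin; zero; suc; _≟_; _<_)
open import Data.Fin.Permutation using (Permutation′; _⟨$⟩ʳ_; _⟨$⟩ˡ_)
open import Data.Product using (Σ; _×_; ∃)
open import Relation.Nullary using (¬_; yes; no)
open import Relation.Nullary.Decidable using (⌊_⌋)
open import Data.Fin using (_<?_)
open import Data.Bool using (Bool; true; false; if_then_else_)
open import Relation.Binary.PropositionalEquality using (_≡_)

data ℤ∞ : Set where
  fin : ℤ → ℤ∞
  ∞   : ℤ∞

infix 4 _≤∞_
data _≤∞_ : ℤ∞ → ℤ∞ → Set where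
  fin≤fin : ∀ {a b} → a ℤ.≤ b → fin a ≤∞ fin b
  _≤∞∞    : ∀ x → x ≤∞ ∞

_+∞_ : ℤ∞ → ℤ∞ → ℤ∞
fin a +∞ fin b = fin (a ℤ.+ b)
_     +∞ _     = ∞

min∞ : ℤ∞ → ℤ∞ → ℤ∞
min∞ (fin a) (fin b) = fin (a ℤ.⊓ b)
min∞ (fin a) ∞       = fin a
min∞ ∞       y       = y

max∞ : ℤ∞ → ℤ∞ → ℤ∞
max∞ (fin a) (fin b) = fin (a ℤ.⊔ b)
max∞ _       ∞       = ∞
max∞ ∞       _       = ∞

minFin : ∀ {d} → (Fin d → ℤ∞) → ℤ∞
minFin {ℕ.zero}  f = ∞
minFin {ℕ.suc d} f = min∞ (f zero) (minFin (λ j → f (suc j)))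

TMat : ℕ → Set
TMat d = Fin d → Fin d → ℤ∞

_⊙_ : ∀ {d} → TMat d → TMat d → TMat d
(A ⊙ B) i k = minFin (λ j → A i j +∞ B j k)

_⊕̄_ : ∀ {d} → TMat d → TMat d → TMat d
(A ⊕̄ B) i k = max∞ (A i k) (B i k)

infixl 7 _⊙_
infixl 6 _⊕̄_

M₀ : ∀ d → TMat d
M₀ d i j = if ⌊ i <? j ⌋ then fin 1ℤ else fin 0ℤ

D : ∀ {d} → (Fin d → ℤ) → TMat d
D u i j with i ≟ j
... | yes _ = fin (u i)
... | no  _ = ∞

-- P_σ = val(h_σ): 0 at (σ(j), j), +∞ elsewhere
P : ∀ {d} → Permutation′ d → TMat d
P σ i j with i ≟ σ ⟨$⟩ʳ j
... | yes _ = fin 0ℤ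
... | no  _ = ∞

Pinv : ∀ {d} → Permutation′ d → TMat d
Pinv σ i j with i ≟ σ ⟨$⟩ˡ j
... | yes _ = fin 0ℤ
... | no  _ = ∞

negV : ∀ {d} → (Fin d → ℤ) → (Fin d → ℤ)
negV u i = ℤ.- (u i)

Mσu : ∀ d → Permutation′ d → (Fin d → ℤ) → TMat d
Mσu d σ u = M₀ d ⊕̄ (P σ ⊙ D u ⊙ M₀ d ⊙ D (negV u) ⊙ Pinv σ)

sumℤ : ∀ {d} → (Fin d → ℤ) → ℤ
sumℤ {ℕ.zero}  f = 0ℤ
sumℤ {ℕ.suc d} f = f zero ℤ.+ sumℤ (λ j → f (suc j))

record DVField c ℓ : Set (lsuc (c ⊔ ℓ)) where
  field
    cring : CommutativeRing c ℓ
  open CommutativeRing cring public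
  field
    0≉1     : ¬ (0# ≈ 1#)
    _⁻¹     : Carrier → Carrier
    ⁻¹-inverse : ∀ x → ¬ (x ≈ 0#) → x * (x ⁻¹) ≈ 1#
    val        : Carrier → ℤ∞
    val-cong   : ∀ {x y} → x ≈ y → val x ≡ val y
    val-∞      : ∀ x → val x ≡ ∞ → x ≈ 0#
    val-0      : val 0# ≡ ∞
    val-*      : ∀ x y → val (x * y) ≡ val x +∞ val y
    val-+      : ∀ x y → min∞ (val x) (val y) ≤∞ val (x + y)
    val-surj   : ∀ (n : ℤ) → Σ Carrier (λ x → val x ≡ fin n)
    p          : Carrier
    val-p      : val p ≡ fin 1ℤ

module DV {c ℓ} (K : DVField c ℓ) where
  open DVField K hiding (zero)

  pow : ℕ → Carrier → Carrier
  pow ℕ.zero    x = 1#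
  pow (ℕ.suc n) x = x * pow n x

  p^ : ℤ → Carrier
  p^ (+ n)     = pow n p
  p^ -[1+ n ]  = pow (ℕ.suc n) (p ⁻¹)

  Vec : ℕ → Set c
  Vec d = Fin d → Carrier

  Mat : ℕ → Set c
  Mat d = Fin d → Fin d → Carrier

  sumK : ∀ {d} → (Fin d → Carrier) → Carrier
  sumK {ℕ.zero}  f = 0#
  sumK {ℕ.suc d} f = f zero + sumK (λ j → f (suc j))

  _·_ : ∀ {d} → Mat d → Mat d → Mat d
  (A · B) i k = sumK (λ j → A i j * B j k)

  _▸_ : ∀ {d} → Mat d → Vec d → Vec d
  (A ▸ x) i = sumK (λ j → A i j * x j)

  infixl 7 _·_
  infixr 6 _▸_

  _≈V_ : ∀ {d} → Vec d → Vec d → Set ℓ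
  x ≈V y = ∀ i → x i ≈ y i

  InO : Carrier → Set
  InO x = fin 0ℤ ≤∞ val x

  InOd : ∀ {d} → Vec d → Set
  InOd x = ∀ i → InO (x i)

  InLat : ∀ {d} → Mat d → Vec d → Set (c ⊔ ℓ)
  InLat A x = Σ (Vec _) (λ y → InOd y × (x ≈V (A ▸ y)))

  InEnd : ∀ {d} → Mat d → Mat d → Set (c ⊔ ℓ)
  InEnd A X = ∀ x → InLat A x → InLat A (X ▸ x)

  diag : ∀ {d} → Vec d → Mat d
  diag v i j with i ≟ j
  ... | yes _ = v i
  ... | no  _ = 0#

  hσ : ∀ {d} → Permutation′ d → Mat d
  hσ σ i j with i ≟ σ ⟨$⟩ʳ j
  ... | yes _ = 1#
  ... | no  _ = 0#

  gu : ∀ {d} → (Fin d → ℤ) → Mat d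
  gu u = diag (λ k → p^ (u k))

  -- v^{(i)} : first i-1 coordinates 1, rest 0 (with 0-indexed i : Fin d,
  -- coordinate k is 1 iff k < i); L_i = diag(p^{v^{(i)}}) O_K^d
  vI : ∀ {d} → Fin d → Fin d → ℤ
  vI i k = if ⌊ k <? i ⌋ then 1ℤ else 0ℤ

  Lmat : ∀ {d} → Fin d → Mat d
  Lmat i = diag (λ k → p^ (vI i k))

  InΛ : ∀ {d} → TMat d → Mat d → Set
  InΛ M X = ∀ i j → M i j ≤∞ val (X i j)

{-# OPTIONS --safe #-}
-- Each lattice L_i and wL_i is monomial: it is A·O_K^d with A = (permutation π)·diag(p^e), so
-- L = {x : val x_a ≥ e(π⁻¹ a)} and End(L) = Λ_M with M_ab = e(π⁻¹ a) − e(π⁻¹ b).  For a family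
-- sharing π, the intersection of the End(L_i) is Λ of the entrywise maximum over i.  For the L_i
-- (π = id, e = v^(i)) that maximum is M₀; for the wL_i (π = σ, e = u + v^(i)) it is
-- u_j − u_k + (M₀)_jk with j = σ⁻¹ a, k = σ⁻¹ b, which is what the tropical conjugate
-- P_σ ⊙ D_u ⊙ M₀ ⊙ D_{−u} ⊙ P_{σ⁻¹} computes entrywise.
module Submission where

open import Defs
open import Data.Bool using (true; false; if_then_else_)
open import Data.Empty using (⊥-elim)
open import Data.Nat as ℕ using (ℕ; _≤_; z≤n)
import Data.Nat.Properties as ℕP
import Data.Fin.Properties as FinP
open import Data.Integer as ℤ using (ℤ; +_; -[1+_]; 0ℤ; 1ℤ; -1ℤ; +≤+; -≤+)
import Data.Integer.Properties as ℤP
open import Data.Integer.Solver using (module +-*-Solver)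
open import Algebra.Properties.AbelianGroup ℤP.+-0-abelianGroup
  using (identityˡ-unique; inverseʳ-unique)
open import Data.Fin as Fin using (Fin; zero; suc; _≟_; _<?_)
open import Data.Fin.Permutation
  using (Permutation′; _⟨$⟩ʳ_; _⟨$⟩ˡ_; inverseˡ; inverseʳ; id; flip; _∘ₚ_)
open import Data.Product using (∃; _×_; _,_; proj₁; proj₂)
open import Data.Product.Function.NonDependent.Propositional using (_×-⇔_)
open import Function.Base using (_∘′_)
open import Function.Bundles using (_⇔_; mk⇔; Equivalence)
open import Function.Construct.Composition using (_⇔-∘_)
open import Function.Construct.Symmetry using (⇔-sym)
open import Relation.Nullary using (¬_; Dec; yes; no)
open import Relation.Nullary.Decidable using (⌊_⌋)
open import Relation.Binary.PropositionalEquality as ≡ using (_≡_; _≢_)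

open Equivalence using (to; from)

fin-injective : ∀ {a b} → fin a ≡ fin b → a ≡ b
fin-injective ≡.refl = ≡.refl

≤∞-refl : ∀ {x} → x ≤∞ x
≤∞-refl {fin a} = fin≤fin ℤP.≤-refl
≤∞-refl {∞}     = ∞ ≤∞∞

≤∞-trans : ∀ {x y z} → x ≤∞ y → y ≤∞ z → x ≤∞ z
≤∞-trans (fin≤fin p) (fin≤fin q) = fin≤fin (ℤP.≤-trans p q)
≤∞-trans _           (_ ≤∞∞)     = _ ≤∞∞

≡⇒≤∞ : ∀ {x y} → x ≡ y → x ≤∞ y
≡⇒≤∞ ≡.refl = ≤∞-refl

min∞-glb : ∀ {n x y} → fin n ≤∞ x → fin n ≤∞ y → fin n ≤∞ min∞ x y
min∞-glb (fin≤fin p) (fin≤fin q) = fin≤fin (ℤP.⊓-glb p q)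
min∞-glb (fin≤fin p) (_ ≤∞∞)     = fin≤fin p
min∞-glb (_ ≤∞∞)     q           = q

+∞-∞ : ∀ x → x +∞ ∞ ≡ ∞
+∞-∞ (fin _) = ≡.refl
+∞-∞ ∞       = ≡.refl

+∞-mono : ∀ {m n x y} → fin m ≤∞ x → fin n ≤∞ y → fin (m ℤ.+ n) ≤∞ x +∞ y
+∞-mono (fin≤fin p) (fin≤fin q) = fin≤fin (ℤP.+-mono-≤ p q)
+∞-mono (fin≤fin _) (_ ≤∞∞)     = _ ≤∞∞
+∞-mono (_ ≤∞∞)     _           = _ ≤∞∞

+∞-cancelʳ : ∀ {m n x} → fin m ≤∞ x +∞ fin n → fin (m ℤ.- n) ≤∞ x
+∞-cancelʳ {m} {n} {fin a} (fin≤fin p) =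
  fin≤fin (ℤP.≤-trans (ℤP.+-monoˡ-≤ (ℤ.- n) p) (ℤP.≤-reflexive (a+n-n≡a a n)))
  where
  open +-*-Solver
  a+n-n≡a : ∀ a n → a ℤ.+ n ℤ.- n ≡ a
  a+n-n≡a = solve 2 (λ a n → a :+ n :- n := a) ≡.refl
+∞-cancelʳ {x = ∞} _ = _ ≤∞∞

max∞-fin-lub⇔ : ∀ {m n x} → max∞ (fin m) (fin n) ≤∞ x ⇔ (fin m ≤∞ x × fin n ≤∞ x)
max∞-fin-lub⇔ {m} {n} = mk⇔ split join
  where
  split : ∀ {x} → max∞ (fin m) (fin n) ≤∞ x → fin m ≤∞ x × fin n ≤∞ x
  split (fin≤fin p) = fin≤fin (ℤP.≤-trans (ℤP.i≤i⊔j m n) p) , fin≤fin (ℤP.≤-trans (ℤP.i≤j⊔i m n) p)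
  split (_ ≤∞∞)     = _ ≤∞∞ , _ ≤∞∞
  join : ∀ {x} → fin m ≤∞ x × fin n ≤∞ x → max∞ (fin m) (fin n) ≤∞ x
  join (fin≤fin p , fin≤fin q) = fin≤fin (ℤP.⊔-lub p q)
  join (_ ≤∞∞     , _)         = _ ≤∞∞

IsAttainedMax : {I : Set} → (I → ℤ) → ℤ → Set
IsAttainedMax g m = (∀ i → g i ℤ.≤ m) × ∃ λ i → g i ≡ m

attainedMax-shift : ∀ {I : Set} {g h : I → ℤ} {m} t →
  IsAttainedMax g m → (∀ i → h i ≡ t ℤ.+ g i) → IsAttainedMax h (t ℤ.+ m)
attainedMax-shift t (bound , i , gi≡m) h≡t+g =
  (λ j → ℤP.≤-trans (ℤP.≤-reflexive (h≡t+g j)) (ℤP.+-monoʳ-≤ t (bound j))) ,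
  i , ≡.trans (h≡t+g i) (≡.cong (λ s → t ℤ.+ s) gi≡m)

fin-≤∞-attainedMax⇔ : ∀ {I : Set} {g : I → ℤ} {m} → IsAttainedMax g m →
  ∀ x → (∀ i → fin (g i) ≤∞ x) ⇔ fin m ≤∞ x
fin-≤∞-attainedMax⇔ {g = g} (bound , i , gi≡m) x =
  mk⇔ (λ h → ≡.subst (λ t → fin t ≤∞ x) gi≡m (h i))
      (λ h j → ≤∞-trans (fin≤fin (bound j)) h)

m₀ : ∀ {d} → Fin d → Fin d → ℤ
m₀ j k = if ⌊ j <? k ⌋ then 1ℤ else 0ℤ

M₀≡fin-m₀ : ∀ d (j k : Fin d) → M₀ d j k ≡ fin (m₀ j k)
M₀≡fin-m₀ d j k with ⌊ j <? k ⌋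
... | true  = ≡.refl
... | false = ≡.refl

m₀-nonneg : ∀ {d} (j k : Fin d) → 0ℤ ℤ.≤ m₀ j k
m₀-nonneg j k with ⌊ j <? k ⌋
... | true  = +≤+ z≤n
... | false = +≤+ z≤n

m₀-< : ∀ {d} {j k : Fin d} → j Fin.< k → m₀ j k ≡ 1ℤ
m₀-< {j = j} {k} j<k with j <? k
... | yes _   = ≡.refl
... | no j≮k = ⊥-elim (j≮k j<k)

m₀-≮ : ∀ {d} {j k : Fin d} → ¬ j Fin.< k → m₀ j k ≡ 0ℤ
m₀-≮ {j = j} {k} j≮k with j <? k
... | yes j<k = ⊥-elim (j≮k j<k)
... | no _    = ≡.refl

m₀-triangle : ∀ {d} (i j k : Fin d) → m₀ j i ℤ.- m₀ k i ℤ.≤ m₀ j k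
m₀-triangle i j k with j <? i | k <? i
... | yes _   | yes _   = m₀-nonneg j k
... | no _    | no _    = m₀-nonneg j k
... | no _    | yes _   = ℤP.≤-trans -≤+ (m₀-nonneg j k)
... | yes j<i | no k≮i with j <? k
...   | yes _   = ℤP.≤-refl
...   | no j≮k  = ⊥-elim (k≮i (ℕP.≤-<-trans (ℕP.≮⇒≥ j≮k) j<i))

m₀-diff-attainedMax : ∀ {d} (j k : Fin d) → IsAttainedMax (λ i → m₀ j i ℤ.- m₀ k i) (m₀ j k)
m₀-diff-attainedMax {ℕ.suc _} j k = (λ i → m₀-triangle i j k) , attained (j <? k)
  where
  attained : Dec (j Fin.< k) → ∃ λ i → m₀ j i ℤ.- m₀ k i ≡ m₀ j k
  attained (yes j<k) =
    k , ≡.trans (≡.cong₂ ℤ._-_ (m₀-< j<k) (m₀-≮ (FinP.<-irrefl ≡.refl))) (≡.sym (m₀-< j<k))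
  attained (no j≮k) =
    zero , ≡.trans (≡.cong₂ ℤ._-_ (m₀-≮ {j = j} {zero} λ ()) (m₀-≮ {j = k} {zero} λ ())) (≡.sym (m₀-≮ j≮k))

≢⟨$⟩ˡ⇒≢⟨$⟩ʳ : ∀ {d} (π : Permutation′ d) {a b} → b ≢ π ⟨$⟩ˡ a → a ≢ π ⟨$⟩ʳ b
≢⟨$⟩ˡ⇒≢⟨$⟩ʳ π b≢ a≡ = b≢ (≡.trans (≡.sym (inverseˡ π)) (≡.cong (π ⟨$⟩ˡ_) (≡.sym a≡)))

minFin-∞ : ∀ {d} (g : Fin d → ℤ∞) → (∀ j → g j ≡ ∞) → minFin g ≡ ∞
minFin-∞ {ℕ.zero}  g g≡∞ = ≡.refl
minFin-∞ {ℕ.suc d} g g≡∞ rewrite g≡∞ zero = minFin-∞ (λ j → g (suc j)) (λ j → g≡∞ (suc j))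

min∞-∞ : ∀ x → min∞ x ∞ ≡ x
min∞-∞ (fin _) = ≡.refl
min∞-∞ ∞       = ≡.refl

minFin-single : ∀ {d} (g : Fin d → ℤ∞) j₀ → (∀ j → j ≢ j₀ → g j ≡ ∞) → minFin g ≡ g j₀
minFin-single {ℕ.suc d} g zero g≡∞ =
  ≡.trans (≡.cong (min∞ (g zero)) (minFin-∞ _ λ j → g≡∞ (suc j) λ ())) (min∞-∞ (g zero))
minFin-single {ℕ.suc d} g (suc j₀) g≡∞ rewrite g≡∞ zero (λ ()) =
  minFin-single (λ j → g (suc j)) j₀ λ j j≢j₀ → g≡∞ (suc j) (λ e → j≢j₀ (FinP.suc-injective e))

record IsTropMonomial {d} (π : Permutation′ d) (e : Fin d → ℤ) (A : TMat d) : Set where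
  field
    on  : ∀ {a b} → a ≡ π ⟨$⟩ʳ b → A a b ≡ fin (e b)
    off : ∀ {a b} → a ≢ π ⟨$⟩ʳ b → A a b ≡ ∞

open IsTropMonomial

P-monomial : ∀ {d} (σ : Permutation′ d) → IsTropMonomial σ (λ _ → 0ℤ) (P σ)
P-monomial σ = record { on = P-on ; off = P-off }
  where
  P-on : ∀ {a b} → a ≡ σ ⟨$⟩ʳ b → P σ a b ≡ fin 0ℤ
  P-on {a} {b} a≡ with a ≟ σ ⟨$⟩ʳ b
  ... | yes _ = ≡.refl
  ... | no a≢ = ⊥-elim (a≢ a≡)
  P-off : ∀ {a b} → a ≢ σ ⟨$⟩ʳ b → P σ a b ≡ ∞
  P-off {a} {b} a≢ with a ≟ σ ⟨$⟩ʳ b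
  ... | yes a≡ = ⊥-elim (a≢ a≡)
  ... | no _   = ≡.refl

Pinv-monomial : ∀ {d} (σ : Permutation′ d) → IsTropMonomial (flip σ) (λ _ → 0ℤ) (Pinv σ)
Pinv-monomial σ = record { on = Pinv-on ; off = Pinv-off }
  where
  Pinv-on : ∀ {a b} → a ≡ σ ⟨$⟩ˡ b → Pinv σ a b ≡ fin 0ℤ
  Pinv-on {a} {b} a≡ with a ≟ σ ⟨$⟩ˡ b
  ... | yes _ = ≡.refl
  ... | no a≢ = ⊥-elim (a≢ a≡)
  Pinv-off : ∀ {a b} → a ≢ σ ⟨$⟩ˡ b → Pinv σ a b ≡ ∞
  Pinv-off {a} {b} a≢ with a ≟ σ ⟨$⟩ˡ b
  ... | yes a≡ = ⊥-elim (a≢ a≡)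
  ... | no _   = ≡.refl

D-monomial : ∀ {d} (u : Fin d → ℤ) → IsTropMonomial id u (D u)
D-monomial u = record { on = D-on ; off = D-off }
  where
  D-on : ∀ {a b} → a ≡ b → D u a b ≡ fin (u b)
  D-on {a} {b} a≡b with a ≟ b
  ... | yes _   = ≡.cong (fin ∘′ u) a≡b
  ... | no a≢b = ⊥-elim (a≢b a≡b)
  D-off : ∀ {a b} → a ≢ b → D u a b ≡ ∞
  D-off {a} {b} a≢b with a ≟ b
  ... | yes a≡b = ⊥-elim (a≢b a≡b)
  ... | no _    = ≡.refl

⊙-monomialʳ : ∀ {d π e} {B : TMat d} → IsTropMonomial π e B →
  ∀ (A : TMat d) a b → (A ⊙ B) a b ≡ A a (π ⟨$⟩ʳ b) +∞ fin (e b)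
⊙-monomialʳ {π = π} B-mon A a b =
  ≡.trans (minFin-single _ (π ⟨$⟩ʳ b) λ j j≢ →
            ≡.trans (≡.cong (A a j +∞_) (off B-mon j≢)) (+∞-∞ (A a j)))
          (≡.cong (A a (π ⟨$⟩ʳ b) +∞_) (on B-mon ≡.refl))

⊙-monomialˡ : ∀ {d π e} {A : TMat d} → IsTropMonomial π e A →
  ∀ (B : TMat d) a b → (A ⊙ B) a b ≡ fin (e (π ⟨$⟩ˡ a)) +∞ B (π ⟨$⟩ˡ a) b
⊙-monomialˡ {π = π} A-mon B a b =
  ≡.trans (minFin-single _ (π ⟨$⟩ˡ a) λ j j≢ →
            ≡.cong (_+∞ B j b) (off A-mon (≢⟨$⟩ˡ⇒≢⟨$⟩ʳ π j≢)))
          (≡.cong (_+∞ B (π ⟨$⟩ˡ a) b) (on A-mon (≡.sym (inverseʳ π))))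

⊙-monomial : ∀ {d π ρ e f} {A B : TMat d} → IsTropMonomial π e A → IsTropMonomial ρ f B →
  IsTropMonomial (ρ ∘ₚ π) (λ b → e (ρ ⟨$⟩ʳ b) ℤ.+ f b) (A ⊙ B)
⊙-monomial {A = A} A-mon B-mon = record
  { on  = λ {a} {b} a≡ → ≡.trans (⊙-monomialʳ B-mon A a b) (≡.cong (_+∞ _) (on A-mon a≡))
  ; off = λ {a} {b} a≢ → ≡.trans (⊙-monomialʳ B-mon A a b) (≡.cong (_+∞ _) (off A-mon a≢))
  }

conjugate-M₀-entry : ∀ {d} (σ : Permutation′ d) (u : Fin d → ℤ) a b →
  let j = σ ⟨$⟩ˡ a ; k = σ ⟨$⟩ˡ b in
  (P σ ⊙ D u ⊙ M₀ d ⊙ D (negV u) ⊙ Pinv σ) a b ≡ fin (u j ℤ.- u k ℤ.+ m₀ j k)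
conjugate-M₀-entry {d} σ u a b = begin
  (P σ ⊙ D u ⊙ M₀ d ⊙ D (negV u) ⊙ Pinv σ) a b
    ≡⟨ ⊙-monomialʳ (Pinv-monomial σ) (P σ ⊙ D u ⊙ M₀ d ⊙ D (negV u)) a b ⟩
  (P σ ⊙ D u ⊙ M₀ d ⊙ D (negV u)) a k +∞ fin 0ℤ
    ≡⟨ ≡.cong (_+∞ fin 0ℤ) (⊙-monomialʳ (D-monomial (negV u)) (P σ ⊙ D u ⊙ M₀ d) a k) ⟩
  ((P σ ⊙ D u ⊙ M₀ d) a k +∞ fin (ℤ.- u k)) +∞ fin 0ℤ
    ≡⟨ ≡.cong (λ x → (x +∞ fin (ℤ.- u k)) +∞ fin 0ℤ)
              (⊙-monomialˡ (⊙-monomial (P-monomial σ) (D-monomial u)) (M₀ d) a k) ⟩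
  ((fin (0ℤ ℤ.+ u j) +∞ M₀ d j k) +∞ fin (ℤ.- u k)) +∞ fin 0ℤ
    ≡⟨ ≡.cong (λ x → ((fin (0ℤ ℤ.+ u j) +∞ x) +∞ fin (ℤ.- u k)) +∞ fin 0ℤ) (M₀≡fin-m₀ d j k) ⟩
  fin ((((0ℤ ℤ.+ u j) ℤ.+ m₀ j k) ℤ.- u k) ℤ.+ 0ℤ)
    ≡⟨ ≡.cong fin (rearrange (u j) (u k) (m₀ j k)) ⟩
  fin (u j ℤ.- u k ℤ.+ m₀ j k) ∎
  where
  open ≡.≡-Reasoning
  open +-*-Solver
  j = σ ⟨$⟩ˡ a
  k = σ ⟨$⟩ˡ b
  rearrange : ∀ x y m → (((0ℤ ℤ.+ x) ℤ.+ m) ℤ.- y) ℤ.+ 0ℤ ≡ x ℤ.- y ℤ.+ m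
  rearrange = solve 3 (λ x y m → (((con 0ℤ :+ x) :+ m) :- y) :+ con 0ℤ := x :- y :+ m) ≡.refl

Mσu-entry : ∀ d (σ : Permutation′ d) (u : Fin d → ℤ) a b →
  let j = σ ⟨$⟩ˡ a ; k = σ ⟨$⟩ˡ b in
  Mσu d σ u a b ≡ max∞ (fin (m₀ a b)) (fin (u j ℤ.- u k ℤ.+ m₀ j k))
Mσu-entry d σ u a b = ≡.cong₂ max∞ (M₀≡fin-m₀ d a b) (conjugate-M₀-entry σ u a b)

Δ : ∀ {d} → (Fin d → ℤ) → TMat d
Δ f a b = fin (f a ℤ.- f b)

module _ {c ℓ} (K : DVField c ℓ) where

  open DVField K hiding (zero)
  open DV K

  val-1 : val 1# ≡ fin 0ℤ
  val-1 with val 1# in val1≡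
  ... | ∞     = ⊥-elim (0≉1 (sym (val-∞ 1# val1≡)))
  ... | fin a = ≡.cong fin (identityˡ-unique a a (fin-injective a+a≡a))
    where
    a+a≡a : fin a +∞ fin a ≡ fin a
    a+a≡a = ≡.trans (≡.cong₂ _+∞_ (≡.sym val1≡) (≡.sym val1≡))
              (≡.trans (≡.sym (val-* 1# 1#)) (≡.trans (val-cong (*-identityˡ 1#)) val1≡))

  val-fin⇒≉0 : ∀ {x n} → val x ≡ fin n → ¬ x ≈ 0#
  val-fin⇒≉0 val≡ x≈0 with ≡.trans (≡.sym val≡) (≡.trans (val-cong x≈0) val-0)
  ... | ()

  val-⁻¹ : ∀ {x n} → val x ≡ fin n → val (x ⁻¹) ≡ fin (ℤ.- n)
  val-⁻¹ {x} {n} val≡ with val (x ⁻¹) | val-x+val-x⁻¹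
    where
    val-x+val-x⁻¹ : fin n +∞ val (x ⁻¹) ≡ fin 0ℤ
    val-x+val-x⁻¹ = ≡.trans (≡.cong (_+∞ val (x ⁻¹)) (≡.sym val≡))
      (≡.trans (≡.sym (val-* x (x ⁻¹))) (≡.trans (val-cong (⁻¹-inverse x (val-fin⇒≉0 val≡))) val-1))
  ... | fin b | n+b≡0 = ≡.cong fin (inverseʳ-unique n b (fin-injective n+b≡0))
  ... | ∞     | ()

  val-pow : ∀ {x n} m → val x ≡ fin n → val (pow m x) ≡ fin (+ m ℤ.* n)
  val-pow ℕ.zero    _     = val-1
  val-pow (ℕ.suc m) val≡ = ≡.trans (val-* _ _)
    (≡.trans (≡.cong₂ _+∞_ val≡ (val-pow m val≡)) (≡.cong fin (≡.sym (ℤP.suc-* (+ m) _))))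

  val-p^ : ∀ z → val (p^ z) ≡ fin z
  val-p^ (+ m)     = ≡.trans (val-pow m val-p) (≡.cong fin (ℤP.*-identityʳ (+ m)))
  val-p^ -[1+ m ] = ≡.trans (val-pow (ℕ.suc m) (val-⁻¹ val-p))
    (≡.cong fin (≡.trans (ℤP.*-comm (+ ℕ.suc m) -1ℤ) (ℤP.-1*i≡-i (+ ℕ.suc m))))

  sumK-zero : ∀ {d} {f : Fin d → Carrier} → (∀ j → f j ≈ 0#) → sumK f ≈ 0#
  sumK-zero {ℕ.zero}  _    = refl
  sumK-zero {ℕ.suc d} f≈0 = trans (+-cong (f≈0 zero) (sumK-zero (λ j → f≈0 (suc j)))) (+-identityˡ 0#)

  sumK-single : ∀ {d} {f : Fin d → Carrier} j₀ → (∀ j → j ≢ j₀ → f j ≈ 0#) → sumK f ≈ f j₀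
  sumK-single {ℕ.suc d} {f} zero f≈0 =
    trans (+-congˡ (sumK-zero λ j → f≈0 (suc j) λ ())) (+-identityʳ (f zero))
  sumK-single {ℕ.suc d} {f} (suc j₀) f≈0 =
    trans (+-cong (f≈0 zero λ ()) (sumK-single j₀ λ j j≢j₀ → f≈0 (suc j) (λ e → j≢j₀ (FinP.suc-injective e))))
          (+-identityˡ (f (suc j₀)))

  val-sumK : ∀ {d n} (f : Fin d → Carrier) → (∀ j → fin n ≤∞ val (f j)) → fin n ≤∞ val (sumK f)
  val-sumK {ℕ.zero}  f _  rewrite val-0 = _ ≤∞∞
  val-sumK {ℕ.suc d} f ≤f =
    ≤∞-trans (min∞-glb (≤f zero) (val-sumK (λ j → f (suc j)) (λ j → ≤f (suc j)))) (val-+ _ _)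

  val-*-mono : ∀ {m n x y} → fin m ≤∞ val x → fin n ≤∞ val y → fin (m ℤ.+ n) ≤∞ val (x * y)
  val-*-mono m≤ n≤ = ≤∞-trans (+∞-mono m≤ n≤) (≡⇒≤∞ (≡.sym (val-* _ _)))

  record IsMonomial {d} (π : Permutation′ d) (s : Vec d) (A : Mat d) : Set ℓ where
    field
      on  : ∀ {a b} → a ≡ π ⟨$⟩ʳ b → A a b ≈ s b
      off : ∀ {a b} → a ≢ π ⟨$⟩ʳ b → A a b ≈ 0#

  open IsMonomial

  diag-monomial : ∀ {d} (v : Vec d) → IsMonomial id v (diag v)
  diag-monomial v = record { on = diag-on ; off = diag-off }
    where
    diag-on : ∀ {a b} → a ≡ b → diag v a b ≈ v b
    diag-on {a} {b} a≡b with a ≟ b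
    ... | yes _   = reflexive (≡.cong v a≡b)
    ... | no a≢b = ⊥-elim (a≢b a≡b)
    diag-off : ∀ {a b} → a ≢ b → diag v a b ≈ 0#
    diag-off {a} {b} a≢b with a ≟ b
    ... | yes a≡b = ⊥-elim (a≢b a≡b)
    ... | no _    = refl

  hσ-monomial : ∀ {d} (σ : Permutation′ d) → IsMonomial σ (λ _ → 1#) (hσ σ)
  hσ-monomial σ = record { on = hσ-on ; off = hσ-off }
    where
    hσ-on : ∀ {a b} → a ≡ σ ⟨$⟩ʳ b → hσ σ a b ≈ 1#
    hσ-on {a} {b} a≡ with a ≟ σ ⟨$⟩ʳ b
    ... | yes _ = refl
    ... | no a≢ = ⊥-elim (a≢ a≡)
    hσ-off : ∀ {a b} → a ≢ σ ⟨$⟩ʳ b → hσ σ a b ≈ 0#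
    hσ-off {a} {b} a≢ with a ≟ σ ⟨$⟩ʳ b
    ... | yes a≡ = ⊥-elim (a≢ a≡)
    ... | no _   = refl

  ▸-monomial : ∀ {d π s} {A : Mat d} → IsMonomial π s A →
    ∀ y a → (A ▸ y) a ≈ s (π ⟨$⟩ˡ a) * y (π ⟨$⟩ˡ a)
  ▸-monomial {π = π} {A = A} A-mon y a =
    trans (sumK-single (π ⟨$⟩ˡ a) λ j j≢ → trans (*-congʳ (off A-mon (≢⟨$⟩ˡ⇒≢⟨$⟩ʳ π j≢))) (zeroˡ (y j)))
          (*-congʳ (on A-mon (≡.sym (inverseʳ π))))

  ·-monomial : ∀ {d π ρ s t} {A B : Mat d} → IsMonomial π s A → IsMonomial ρ t B →
    IsMonomial (ρ ∘ₚ π) (λ b → s (ρ ⟨$⟩ʳ b) * t b) (A · B)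
  ·-monomial {ρ = ρ} {t = t} {A} {B} A-mon B-mon = record
    { on  = λ a≡ → trans ·-entry (*-congʳ (on A-mon a≡))
    ; off = λ a≢ → trans ·-entry (trans (*-congʳ (off A-mon a≢)) (zeroˡ _))
    }
    where
    ·-entry : ∀ {a b} → (A · B) a b ≈ A a (ρ ⟨$⟩ʳ b) * t b
    ·-entry {a} {b} =
      trans (sumK-single (ρ ⟨$⟩ʳ b) λ j j≢ → trans (*-congˡ (off B-mon j≢)) (zeroʳ (A a j)))
            (*-congˡ (on B-mon ≡.refl))

  ValAtLeast : ∀ {d} → (Fin d → ℤ) → Vec d → Set
  ValAtLeast f x = ∀ a → fin (f a) ≤∞ val (x a)

  ▸-ValAtLeast : ∀ {d f} {X : Mat d} {x} → InΛ (Δ f) X → ValAtLeast f x → ValAtLeast f (X ▸ x)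
  ▸-ValAtLeast {f = f} X∈Λ x≥ a = val-sumK _ λ b →
    ≡.subst (λ t → fin t ≤∞ _) (i-j+j≡i (f a) (f b)) (val-*-mono (X∈Λ a b) (x≥ b))
    where
    open +-*-Solver
    i-j+j≡i : ∀ i j → i ℤ.- j ℤ.+ j ≡ i
    i-j+j≡i = solve 2 (λ i j → i :- j :+ j := i) ≡.refl

  unitVec : ∀ {d} → Fin d → Carrier → Vec d
  unitVec b t m = diag (λ _ → t) m b

  ▸-unitVec : ∀ {d} (X : Mat d) b t a → (X ▸ unitVec b t) a ≈ X a b * t
  ▸-unitVec X b t a =
    trans (sumK-single b λ m m≢b → trans (*-congˡ (off (diag-monomial (λ _ → t)) m≢b)) (zeroʳ (X a m)))
          (*-congˡ (on (diag-monomial (λ _ → t)) {b} ≡.refl))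

  module MonomialLattice {d π s} {A : Mat d} (A-mon : IsMonomial π s A)
                         (e : Fin d → ℤ) (val-s : ∀ k → val (s k) ≡ fin (e k)) where

    open import Relation.Binary.Reasoning.Setoid setoid

    f : Fin d → ℤ
    f a = e (π ⟨$⟩ˡ a)

    InLat⇒ValAtLeast : ∀ {x} → InLat A x → ValAtLeast f x
    InLat⇒ValAtLeast (y , y∈O , x≈Ay) a = ≤∞-trans
      (≡.subst (λ t → fin t ≤∞ _) (ℤP.+-identityʳ (f a)) (val-*-mono (≡⇒≤∞ (≡.sym (val-s _))) (y∈O _)))
      (≡⇒≤∞ (val-cong (sym (trans (x≈Ay a) (▸-monomial A-mon y a)))))

    ValAtLeast⇒InLat : ∀ {x} → ValAtLeast f x → InLat A x
    ValAtLeast⇒InLat {x} x≥ = y , y∈O , x≈Ay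
      where
      y : Vec d
      y k = s k ⁻¹ * x (π ⟨$⟩ʳ k)
      y∈O : InOd y
      y∈O k = ≡.subst (λ t → fin t ≤∞ val (y k)) (ℤP.+-inverseˡ (e k))
        (val-*-mono (≡⇒≤∞ (≡.sym (val-⁻¹ (val-s k))))
                    (≡.subst (λ j → fin (e j) ≤∞ val (x (π ⟨$⟩ʳ k))) (inverseˡ π) (x≥ (π ⟨$⟩ʳ k))))
      x≈Ay : x ≈V (A ▸ y)
      x≈Ay a = sym (begin
        (A ▸ y) a                      ≈⟨ ▸-monomial A-mon y a ⟩
        s j * (s j ⁻¹ * x (π ⟨$⟩ʳ j)) ≈⟨ *-assoc _ _ _ ⟨
        (s j * s j ⁻¹) * x (π ⟨$⟩ʳ j) ≈⟨ *-congʳ (⁻¹-inverse _ (val-fin⇒≉0 (val-s j))) ⟩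
        1# * x (π ⟨$⟩ʳ j)             ≈⟨ *-identityˡ _ ⟩
        x (π ⟨$⟩ʳ j)                  ≡⟨ ≡.cong x (inverseʳ π) ⟩
        x a                            ∎)
        where j = π ⟨$⟩ˡ a

    unitVec∈Lat : ∀ b → InLat A (unitVec b (s (π ⟨$⟩ˡ b)))
    unitVec∈Lat b = ValAtLeast⇒InLat unitVec≥
      where
      unitVec≥ : ValAtLeast f (unitVec b (s (π ⟨$⟩ˡ b)))
      unitVec≥ m with m ≟ b
      ... | yes ≡.refl = ≡⇒≤∞ (≡.sym (val-s _))
      ... | no _       = ≡.subst (fin (f m) ≤∞_) (≡.sym val-0) (fin (f m) ≤∞∞)

    InEnd⇔InΛ : ∀ {X} → InEnd A X ⇔ InΛ (Δ f) X
    InEnd⇔InΛ {X} = mk⇔ InEnd⇒InΛ InΛ⇒InEnd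
      where
      InΛ⇒InEnd : InΛ (Δ f) X → InEnd A X
      InΛ⇒InEnd X∈Λ x x∈L = ValAtLeast⇒InLat (▸-ValAtLeast X∈Λ (InLat⇒ValAtLeast x∈L))
      -- X is tested on the lattice vector s_{π⁻¹ b} e_b, whose image has a-th entry X_ab s_{π⁻¹ b}.
      InEnd⇒InΛ : InEnd A X → InΛ (Δ f) X
      InEnd⇒InΛ X∈End a b = +∞-cancelʳ (≤∞-trans
        (InLat⇒ValAtLeast (X∈End _ (unitVec∈Lat b)) a)
        (≡⇒≤∞ (≡.trans (val-cong (▸-unitVec X b _ a))
                       (≡.trans (val-* _ _) (≡.cong (val (X a b) +∞_) (val-s _))))))

  ⋂End⇔InΛ : ∀ {d} {I : Set} {π} {s : I → Vec d} {A : I → Mat d} →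
    (∀ i → IsMonomial π (s i) (A i)) →
    (e : I → Fin d → ℤ) → (∀ i k → val (s i k) ≡ fin (e i k)) →
    (M : Fin d → Fin d → ℤ) →
    (∀ a b → IsAttainedMax (λ i → e i (π ⟨$⟩ˡ a) ℤ.- e i (π ⟨$⟩ˡ b)) (M a b)) →
    ∀ X → (∀ i → InEnd (A i) X) ⇔ InΛ (λ a b → fin (M a b)) X
  ⋂End⇔InΛ {π = π} {A = A} A-mon e val-s M M-max X = mk⇔
    (λ X∈End a b → to (fin-≤∞-attainedMax⇔ (M-max a b) (val (X a b))) λ i → to (End⇔ i) (X∈End i) a b)
    (λ X∈Λ i → from (End⇔ i) λ a b → from (fin-≤∞-attainedMax⇔ (M-max a b) (val (X a b))) (X∈Λ a b) i)
    where
    End⇔ : ∀ i → InEnd (A i) X ⇔ InΛ (Δ (λ a → e i (π ⟨$⟩ˡ a))) X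
    End⇔ i = MonomialLattice.InEnd⇔InΛ (A-mon i) (e i) (val-s i)

  InΛ-cong : ∀ {d} {M N : TMat d} → (∀ a b → M a b ≡ N a b) → ∀ X → InΛ M X ⇔ InΛ N X
  InΛ-cong M≡N X = mk⇔ (λ X∈Λ a b → ≡.subst (_≤∞ _) (M≡N a b) (X∈Λ a b))
                       (λ X∈Λ a b → ≡.subst (_≤∞ _) (≡.sym (M≡N a b)) (X∈Λ a b))

  InΛ-max⇔ : ∀ {d} (M N : Fin d → Fin d → ℤ) X →
    InΛ (λ a b → max∞ (fin (M a b)) (fin (N a b))) X ⇔
    (InΛ (λ a b → fin (M a b)) X × InΛ (λ a b → fin (N a b)) X)
  InΛ-max⇔ M N X = mk⇔
    (λ X∈Λ → (λ a b → proj₁ (to max∞-fin-lub⇔ (X∈Λ a b))) , (λ a b → proj₂ (to max∞-fin-lub⇔ (X∈Λ a b))))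
    (λ (X∈ΛM , X∈ΛN) a b → from max∞-fin-lub⇔ (X∈ΛM a b , X∈ΛN a b))

  -- vI i k is m₀ k i by definition, so m₀-diff-attainedMax applies verbatim.
  Lmat-⋂End⇔InΛ : ∀ {d} (X : Mat d) → (∀ i → InEnd (Lmat i) X) ⇔ InΛ (λ a b → fin (m₀ a b)) X
  Lmat-⋂End⇔InΛ X =
    ⋂End⇔InΛ (λ _ → diag-monomial _) vI (λ i k → val-p^ (vI i k)) m₀ m₀-diff-attainedMax X

  wLmat-⋂End⇔InΛ : ∀ {d} (σ : Permutation′ d) u (X : Mat d) →
    let j = σ ⟨$⟩ˡ_ in
    (∀ i → InEnd ((hσ σ · gu u) · Lmat i) X) ⇔
    InΛ (λ a b → fin (u (j a) ℤ.- u (j b) ℤ.+ m₀ (j a) (j b))) X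
  wLmat-⋂End⇔InΛ σ u X = ⋂End⇔InΛ
    (λ _ → ·-monomial (·-monomial (hσ-monomial σ) (diag-monomial _)) (diag-monomial _))
    (λ i k → u k ℤ.+ vI i k) val-scalar _ shifted-max X
    where
    open +-*-Solver
    val-scalar : ∀ i k → val ((1# * p^ (u k)) * p^ (vI i k)) ≡ fin (u k ℤ.+ vI i k)
    val-scalar i k =
      ≡.trans (val-* _ _) (≡.trans (≡.cong₂ _+∞_ (≡.trans (val-* _ _) (≡.cong₂ _+∞_ val-1 (val-p^ (u k))))
                                                  (val-p^ (vI i k)))
                                   (≡.cong (λ t → fin (t ℤ.+ vI i k)) (ℤP.+-identityˡ (u k))))
    regroup : ∀ x y m n → (x ℤ.+ m) ℤ.- (y ℤ.+ n) ≡ (x ℤ.- y) ℤ.+ (m ℤ.- n)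
    regroup = solve 4 (λ x y m n → (x :+ m) :- (y :+ n) := (x :- y) :+ (m :- n)) ≡.refl
    shifted-max : ∀ a b → let j = σ ⟨$⟩ˡ a ; k = σ ⟨$⟩ˡ b in
      IsAttainedMax (λ i → (u j ℤ.+ vI i j) ℤ.- (u k ℤ.+ vI i k)) (u j ℤ.- u k ℤ.+ m₀ j k)
    shifted-max a b = attainedMax-shift (u j ℤ.- u k) (m₀-diff-attainedMax j k)
                        (λ i → regroup (u j) (u k) (vI i j) (vI i k))
      where j = σ ⟨$⟩ˡ a ; k = σ ⟨$⟩ˡ b

proposition6p3 : ∀ {c ℓ} (K : DVField c ℓ) (d : ℕ) → 2 ≤ d →
  (σ : Permutation′ d) (u : Fin d → ℤ) → sumℤ u ≡ 0ℤ →
  let open DVField K hiding (zero)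
      open DV K
      w = hσ σ · gu u
  in (X : Mat d) →
     ((∀ i → InEnd (Lmat i) X) × (∀ i → InEnd (w · Lmat i) X))
     ⇔ InΛ (Mσu d σ u) X
proposition6p3 K d _ σ u _ X =
  ⇔-sym (InΛ-max⇔ K _ _ X ⇔-∘ InΛ-cong K (Mσu-entry d σ u) X)
  ⇔-∘ (Lmat-⋂End⇔InΛ K X ×-⇔ wLmat-⋂End⇔InΛ K σ u X)
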